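{- Let $(P,\leq)=(P,\land,\lor)$ be a lattice in which every principal order ideal $\{y\in P: y\le x\}$ is finite, and let $f:P\to\mathbb{C}$ be semimultiplicative with $f(x)\neq 0$ for all $x\in P$. Let $n\ge 3$ and let $S=\{x_1,\ldots,x_n\}$ be a meet closed subset of $P$ with distinct elements, indexed so that $x_i<x_j\Rightarrow i<j$, such that $x_i\land x_j=x_1$ for all distinct $i,j\in\{1,\ldots,n-1\}$ and $x_1\lor x_2\lor\cdots\lor x_{n-1}\le x_n$. Then the join matrix $[S]_f$ is invertible if and only if $f(x_k)\neq f(x_1)$ for $k=2,3,\ldots,n-1$ and $$\frac{1}{f(x_n)}\neq\Big(\sum_{k=2}^{n-1}\frac{1}{f(x_k)}\Big)-\frac{n-3}{f(x_1)}.$$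
   Context: $f$ is semimultiplicative if $f(x)f(y)=f(x\land y)f(x\lor y)$ for all $x,y\in P$. A subset $S$ is meet closed if $x,y\in S\Rightarrow x\land y\in S$. The join matrix $[S]_f$ is the $n\times n$ matrix with $(i,j)$ entry $f(x_i\lor x_j)$. -}

module Defs where

open import Level using (Level; _⊔_) renaming (suc to lsuc)
open import Data.Nat using (ℕ; zero; suc)
open import Data.Fin using (Fin) renaming (zero to fzero; suc to fsuc)
open import Data.Product using (Σ; ∃; _×_; _,_)
open import Data.List using (List)
open import Data.List.Relation.Unary.Any using (Any)
open import Relation.Nullary using (¬_)
open import Algebra.Bundles using (CommutativeRing)
open import Relation.Binary.Lattice.Bundles using (Lattice)

-- The inverse is given as a total operation _⁻¹ (its value at 0 is
-- irrelevant), so that 1/a can be written as a ⁻¹.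

record Field c ℓ : Set (lsuc (c ⊔ ℓ)) where
  field
    commutativeRing : CommutativeRing c ℓ
  open CommutativeRing commutativeRing public
  infix 8 _⁻¹
  field
    _⁻¹      : Carrier → Carrier
    0≉1      : ¬ (0# ≈ 1#)
    ⁻¹-inverseʳ : ∀ x → ¬ (x ≈ 0#) → x * (x ⁻¹) ≈ 1#

module FieldOps {c ℓ} (F : Field c ℓ) where
  open Field F

  ∑ : ∀ {n} → (Fin n → Carrier) → Carrier
  ∑ {zero}  g = 0#
  ∑ {suc n} g = g fzero + ∑ (λ i → g (fsuc i))

  _·_ : ℕ → Carrier → Carrier
  zero  · r = 0#
  suc m · r = r + (m · r)

  Matrix : ℕ → Set c
  Matrix n = Fin n → Fin n → Carrier

  _⊛_ : ∀ {n} → Matrix n → Matrix n → Matrix n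
  (A ⊛ B) i j = ∑ (λ k → A i k * B k j)

  I : ∀ {n} → Matrix n
  I fzero    fzero    = 1#
  I fzero    (fsuc j) = 0#
  I (fsuc i) fzero    = 0#
  I (fsuc i) (fsuc j) = I i j

  _≋_ : ∀ {n} → Matrix n → Matrix n → Set ℓ
  A ≋ B = ∀ i j → A i j ≈ B i j

  Invertible : ∀ {n} → Matrix n → Set (c ⊔ ℓ)
  Invertible {n} A = Σ (Matrix n) λ B → (A ⊛ B) ≋ I × (B ⊛ A) ≋ I

module LatticeOps {c ℓ₁ ℓ₂} (L : Lattice c ℓ₁ ℓ₂) where
  open Lattice L

  _<_ : Carrier → Carrier → Set (ℓ₁ ⊔ ℓ₂)
  x < y = x ≤ y × ¬ (x ≈ y)

  LocallyFinite : Set (c ⊔ ℓ₁ ⊔ ℓ₂)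
  LocallyFinite = ∀ x → Σ (List Carrier) λ xs → ∀ y → y ≤ x → Any (y ≈_) xs

  ⋁ : ∀ {k} → (Fin (suc k) → Carrier) → Carrier
  ⋁ {zero}  g = g fzero
  ⋁ {suc k} g = g fzero ∨ ⋁ (λ i → g (fsuc i))

  MeetClosed : ∀ {n} → (Fin n → Carrier) → Set (ℓ₁)
  MeetClosed {n} x = ∀ i j → ∃ λ k → x k ≈ (x i ∧ x j)

module _ {c ℓ₁ ℓ₂ d ℓ} (L : Lattice c ℓ₁ ℓ₂) (F : Field d ℓ) where
  private
    module L = Lattice L
    module F = Field F

  Semimultiplicative : (L.Carrier → F.Carrier) → Set (c ⊔ ℓ)
  Semimultiplicative f = ∀ x y → (f x F.* f y) F.≈ (f (x L.∧ y) F.* f (x L.∨ y))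

  Respects≈ : (L.Carrier → F.Carrier) → Set (c ⊔ ℓ₁ ⊔ ℓ)
  Respects≈ f = ∀ {x y} → x L.≈ y → f x F.≈ f y

  joinMatrix : ∀ {n} → (L.Carrier → F.Carrier) → (Fin n → L.Carrier) → FieldOps.Matrix F n
  joinMatrix f x i j = f (x i L.∨ x j)

-- Since f is semimultiplicative and nowhere zero, f (x ∨ y) = f x f y / f (x ∧ y),
-- so [S]_f = D M D with D = diag (f xᵢ) and M the meet matrix of g = 1/f; thus
-- [S]_f is invertible iff M is.  The hypotheses make S a three-layer poset:
-- x₁ at the bottom, the pairwise incomparable x₂ … xₙ₋₁ (pairwise meet x₁) in the
-- middle, xₙ on top.  Its zeta matrix E has an explicit inverse (the Möbius
-- function), and M = E Δ Eᵀ where Δ is diagonal with the Möbius transform of g: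
-- g x₁, g xₖ − g x₁ (1 < k < n), and g xₙ − Σ_{1<k<n} g xₖ + (n − 3) g x₁.
-- Hence M is invertible iff these are nonzero, which are exactly the stated
-- conditions.

module Submission where

open import Defs
open import Data.Nat using (ℕ; zero; suc)
open import Data.Fin using (Fin; fromℕ; inject₁) renaming (zero to fzero; suc to fsuc)
open import Data.Fin.Properties using (fromℕ≢inject₁; suc-injective; _≟_)
open import Data.Product using (_×_; _,_; proj₁; proj₂)
open import Relation.Nullary using (¬_; contradiction; yes; no)
open import Relation.Binary.Bundles using (Setoid)
open import Relation.Binary.PropositionalEquality as ≡ using (_≡_; _≢_)
open import Function using (_∘_)
open import Function.Bundles using (_⇔_; mk⇔; Equivalence)
open import Function.Properties.Equivalence using () renaming (trans to ⇔-trans)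
open import Data.Maybe using (nothing)
open import Relation.Binary.Lattice.Bundles using (Lattice)
import Algebra.Properties.Semiring.Sum as SemiringSum
import Algebra.Properties.Ring as RingProperties
import Relation.Binary.Reasoning.Setoid
import Relation.Binary.Lattice.Properties.MeetSemilattice as MeetSemilatticeProperties

module Sums {d ℓ} (F : Field d ℓ) where
  open Field F
  open FieldOps F
  open SemiringSum semiring using (sum; sum-cong-≋; sum-init-last; sum-replicate-zero;
    *-distribˡ-sum; *-distribʳ-sum) renaming (∑-distrib-+ to sum-distrib-+; ∑-comm to sum-comm)
  open RingProperties ring using (-0#≈0#; -‿+-comm)
  open import Relation.Binary.Reasoning.Setoid setoid

  ∑≡sum : ∀ {n} (g : Fin n → Carrier) → ∑ g ≡ sum g
  ∑≡sum {zero}  g = ≡.refl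
  ∑≡sum {suc n} g = ≡.cong (g fzero +_) (∑≡sum (g ∘ fsuc))

  ∑-cong : ∀ {n} {g h : Fin n → Carrier} → (∀ i → g i ≈ h i) → ∑ g ≈ ∑ h
  ∑-cong {g = g} {h} g≈h = begin
    ∑ g   ≡⟨ ∑≡sum g ⟩
    sum g ≈⟨ sum-cong-≋ g≈h ⟩
    sum h ≡⟨ ∑≡sum h ⟨
    ∑ h   ∎

  ∑-zero : ∀ {n} {g : Fin n → Carrier} → (∀ i → g i ≈ 0#) → ∑ g ≈ 0#
  ∑-zero {n} g≈0 = trans (∑-cong g≈0) (trans (reflexive (∑≡sum {n} (λ _ → 0#))) (sum-replicate-zero n))

  ∑-distrib-+ : ∀ {n} (g h : Fin n → Carrier) → ∑ (λ i → g i + h i) ≈ ∑ g + ∑ h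
  ∑-distrib-+ g h = begin
    ∑ (λ i → g i + h i)   ≡⟨ ∑≡sum (λ i → g i + h i) ⟩
    sum (λ i → g i + h i) ≈⟨ sum-distrib-+ g h ⟩
    sum g + sum h         ≡⟨ ≡.cong₂ _+_ (∑≡sum g) (∑≡sum h) ⟨
    ∑ g + ∑ h             ∎

  *-distribˡ-∑ : ∀ {n} c (g : Fin n → Carrier) → c * ∑ g ≈ ∑ (λ i → c * g i)
  *-distribˡ-∑ c g = begin
    c * ∑ g               ≡⟨ ≡.cong (c *_) (∑≡sum g) ⟩
    c * sum g             ≈⟨ *-distribˡ-sum c g ⟩
    sum (λ i → c * g i)   ≡⟨ ∑≡sum (λ i → c * g i) ⟨
    ∑ (λ i → c * g i)     ∎

  *-distribʳ-∑ : ∀ {n} c (g : Fin n → Carrier) → ∑ g * c ≈ ∑ (λ i → g i * c)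
  *-distribʳ-∑ c g = begin
    ∑ g * c               ≡⟨ ≡.cong (_* c) (∑≡sum g) ⟩
    sum g * c             ≈⟨ *-distribʳ-sum c g ⟩
    sum (λ i → g i * c)   ≡⟨ ∑≡sum (λ i → g i * c) ⟨
    ∑ (λ i → g i * c)     ∎

  ∑-comm : ∀ {m n} (h : Fin m → Fin n → Carrier) →
            ∑ (λ i → ∑ (λ j → h i j)) ≈ ∑ (λ j → ∑ (λ i → h i j))
  ∑-comm h = begin
    ∑ (λ i → ∑ (λ j → h i j))     ≈⟨ ∑-cong (λ i → reflexive (∑≡sum (h i))) ⟩
    ∑ (λ i → sum (λ j → h i j))   ≡⟨ ∑≡sum (λ i → sum (h i)) ⟩
    sum (λ i → sum (λ j → h i j)) ≈⟨ sum-comm h ⟩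
    sum (λ j → sum (λ i → h i j)) ≡⟨ ∑≡sum (λ j → sum (λ i → h i j)) ⟨
    ∑ (λ j → sum (λ i → h i j))   ≈⟨ ∑-cong (λ j → reflexive (∑≡sum (λ i → h i j))) ⟨
    ∑ (λ j → ∑ (λ i → h i j))     ∎

  ∑-init-last : ∀ {n} (g : Fin (suc n) → Carrier) → ∑ g ≈ ∑ (g ∘ inject₁) + g (fromℕ n)
  ∑-init-last g = begin
    ∑ g                               ≡⟨ ∑≡sum g ⟩
    sum g                             ≈⟨ sum-init-last g ⟩
    sum (g ∘ inject₁) + g (fromℕ _)   ≡⟨ ≡.cong (_+ _) (∑≡sum (g ∘ inject₁)) ⟨
    ∑ (g ∘ inject₁) + g (fromℕ _)     ∎

  ∑-const : ∀ n c → ∑ {n} (λ _ → c) ≈ n · c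
  ∑-const zero    c = refl
  ∑-const (suc n) c = +-congˡ (∑-const n c)

  ·-neg : ∀ n x → n · (- x) ≈ - (n · x)
  ·-neg zero    x = sym -0#≈0#
  ·-neg (suc n) x = trans (+-congˡ (·-neg n x)) (-‿+-comm x (n · x))

module Inverses {d ℓ} (F : Field d ℓ) where
  open Field F
  open import Relation.Binary.Reasoning.Setoid setoid

  ⁻¹-inverseˡ : ∀ x → ¬ x ≈ 0# → x ⁻¹ * x ≈ 1#
  ⁻¹-inverseˡ x x≉0 = trans (*-comm _ _) (⁻¹-inverseʳ x x≉0)

  ⁻¹-unique : ∀ {x y} → ¬ x ≈ 0# → x * y ≈ 1# → y ≈ x ⁻¹
  ⁻¹-unique {x} {y} x≉0 xy≈1 = begin
    y              ≈⟨ *-identityˡ y ⟨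
    1# * y         ≈⟨ *-congʳ (⁻¹-inverseˡ x x≉0) ⟨
    (x ⁻¹ * x) * y ≈⟨ *-assoc _ _ _ ⟩
    x ⁻¹ * (x * y) ≈⟨ *-congˡ xy≈1 ⟩
    x ⁻¹ * 1#      ≈⟨ *-identityʳ _ ⟩
    x ⁻¹           ∎

  ⁻¹-nonzero : ∀ {x} → ¬ x ≈ 0# → ¬ x ⁻¹ ≈ 0#
  ⁻¹-nonzero {x} x≉0 x⁻¹≈0 = 0≉1 (begin
    0#        ≈⟨ zeroʳ x ⟨
    x * 0#    ≈⟨ *-congˡ x⁻¹≈0 ⟨
    x * x ⁻¹  ≈⟨ ⁻¹-inverseʳ x x≉0 ⟩
    1#        ∎)

  ⁻¹-cong : ∀ {x y} → ¬ x ≈ 0# → x ≈ y → x ⁻¹ ≈ y ⁻¹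
  ⁻¹-cong {x} x≉0 x≈y = ⁻¹-unique (x≉0 ∘ trans x≈y) (trans (*-congʳ (sym x≈y)) (⁻¹-inverseʳ x x≉0))

  ⁻¹-involutive : ∀ {x} → ¬ x ≈ 0# → x ⁻¹ ⁻¹ ≈ x
  ⁻¹-involutive {x} x≉0 = sym (⁻¹-unique (⁻¹-nonzero x≉0) (⁻¹-inverseˡ x x≉0))

  ⁻¹-injective : ∀ {x y} → ¬ x ≈ 0# → ¬ y ≈ 0# → x ⁻¹ ≈ y ⁻¹ → x ≈ y
  ⁻¹-injective {x} {y} x≉0 y≉0 x⁻¹≈y⁻¹ = begin
    x        ≈⟨ ⁻¹-involutive x≉0 ⟨
    x ⁻¹ ⁻¹  ≈⟨ ⁻¹-cong (⁻¹-nonzero x≉0) x⁻¹≈y⁻¹ ⟩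
    y ⁻¹ ⁻¹  ≈⟨ ⁻¹-involutive y≉0 ⟩
    y        ∎

module Matrices {d ℓ} (F : Field d ℓ) where
  open Field F
  open FieldOps F
  open Sums F
  open import Relation.Binary.Reasoning.Setoid setoid

  I-diagonal : ∀ {n} (i : Fin n) → I i i ≡ 1#
  I-diagonal fzero    = ≡.refl
  I-diagonal (fsuc i) = I-diagonal i

  I-offDiagonal : ∀ {n} {i j : Fin n} → i ≢ j → I i j ≡ 0#
  I-offDiagonal {i = fzero}  {fzero}  i≢j = contradiction ≡.refl i≢j
  I-offDiagonal {i = fzero}  {fsuc j} i≢j = ≡.refl
  I-offDiagonal {i = fsuc i} {fzero}  i≢j = ≡.refl
  I-offDiagonal {i = fsuc i} {fsuc j} i≢j = I-offDiagonal (i≢j ∘ ≡.cong fsuc)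

  I-inject₁ : ∀ {n} (i j : Fin n) → I (inject₁ i) (inject₁ j) ≡ I i j
  I-inject₁ fzero    fzero    = ≡.refl
  I-inject₁ fzero    (fsuc j) = ≡.refl
  I-inject₁ (fsuc i) fzero    = ≡.refl
  I-inject₁ (fsuc i) (fsuc j) = I-inject₁ i j

  I-sym : ∀ {n} (i j : Fin n) → I i j ≡ I j i
  I-sym fzero    fzero    = ≡.refl
  I-sym fzero    (fsuc j) = ≡.refl
  I-sym (fsuc i) fzero    = ≡.refl
  I-sym (fsuc i) (fsuc j) = I-sym i j

  ∑-siftˡ : ∀ {n} (i : Fin n) (g : Fin n → Carrier) → ∑ (λ j → I i j * g j) ≈ g i
  ∑-siftˡ fzero g = begin
    1# * g fzero + ∑ (λ j → 0# * g (fsuc j)) ≈⟨ +-cong (*-identityˡ _) (∑-zero (λ j → zeroˡ (g (fsuc j)))) ⟩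
    g fzero + 0#                              ≈⟨ +-identityʳ _ ⟩
    g fzero                                   ∎
  ∑-siftˡ (fsuc i) g = begin
    0# * g fzero + ∑ (λ j → I i j * g (fsuc j)) ≈⟨ +-cong (zeroˡ _) (∑-siftˡ i (g ∘ fsuc)) ⟩
    0# + g (fsuc i)                              ≈⟨ +-identityˡ _ ⟩
    g (fsuc i)                                   ∎

  ∑-siftʳ : ∀ {n} (i : Fin n) (g : Fin n → Carrier) → ∑ (λ j → g j * I j i) ≈ g i
  ∑-siftʳ i g = trans (∑-cong λ j → trans (*-comm _ _) (*-congʳ (reflexive (I-sym j i)))) (∑-siftˡ i g)

  ∑-I-column : ∀ {n} (l : Fin n) → ∑ (λ k → I k l) ≈ 1#
  ∑-I-column l = trans (∑-cong λ k → sym (*-identityˡ (I k l))) (∑-siftʳ l (λ _ → 1#))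

  ≋-setoid : ℕ → Setoid d ℓ
  ≋-setoid n = record
    { Carrier       = Matrix n
    ; _≈_           = _≋_
    ; isEquivalence = record
      { refl  = λ _ _ → refl
      ; sym   = λ A≋B i j → sym (A≋B i j)
      ; trans = λ A≋B B≋C i j → trans (A≋B i j) (B≋C i j)
      }
    }

  module ≋ {n} = Setoid (≋-setoid n)

  ⊛-cong : ∀ {n} {A A′ B B′ : Matrix n} → A ≋ A′ → B ≋ B′ → (A ⊛ B) ≋ (A′ ⊛ B′)
  ⊛-cong A≋A′ B≋B′ i j = ∑-cong λ k → *-cong (A≋A′ i k) (B≋B′ k j)

  ⊛-assoc : ∀ {n} (A B C : Matrix n) → ((A ⊛ B) ⊛ C) ≋ (A ⊛ (B ⊛ C))
  ⊛-assoc A B C i j = begin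
    ∑ (λ k → ∑ (λ l → A i l * B l k) * C k j)   ≈⟨ ∑-cong (λ k → *-distribʳ-∑ (C k j) (λ l → A i l * B l k)) ⟩
    ∑ (λ k → ∑ (λ l → (A i l * B l k) * C k j)) ≈⟨ ∑-cong (λ k → ∑-cong λ l → *-assoc (A i l) (B l k) (C k j)) ⟩
    ∑ (λ k → ∑ (λ l → A i l * (B l k * C k j))) ≈⟨ ∑-comm (λ k l → A i l * (B l k * C k j)) ⟩
    ∑ (λ l → ∑ (λ k → A i l * (B l k * C k j))) ≈⟨ ∑-cong (λ l → *-distribˡ-∑ (A i l) (λ k → B l k * C k j)) ⟨
    ∑ (λ l → A i l * ∑ (λ k → B l k * C k j))   ∎

  ⊛-identityˡ : ∀ {n} (A : Matrix n) → (I ⊛ A) ≋ A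
  ⊛-identityˡ A i j = ∑-siftˡ i (λ k → A k j)

  ⊛-identityʳ : ∀ {n} (A : Matrix n) → (A ⊛ I) ≋ A
  ⊛-identityʳ A i j = ∑-siftʳ j (A i)

  _ᵀ : ∀ {n} → Matrix n → Matrix n
  (A ᵀ) i j = A j i

  ⊛-ᵀ : ∀ {n} (A B : Matrix n) → ((A ⊛ B) ᵀ) ≋ ((B ᵀ) ⊛ (A ᵀ))
  ⊛-ᵀ A B i j = ∑-cong λ k → *-comm (A j k) (B k i)

  I-ᵀ : ∀ {n} → (I {n} ᵀ) ≋ I
  I-ᵀ i j = reflexive (I-sym j i)

  diag : ∀ {n} → (Fin n → Carrier) → Matrix n
  diag d i j = d i * I i j

  diag-⊛ : ∀ {n} (d : Fin n → Carrier) (A : Matrix n) i j → (diag d ⊛ A) i j ≈ d i * A i j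
  diag-⊛ d A i j = begin
    ∑ (λ k → (d i * I i k) * A k j) ≈⟨ ∑-cong (λ k → *-assoc (d i) (I i k) (A k j)) ⟩
    ∑ (λ k → d i * (I i k * A k j)) ≈⟨ *-distribˡ-∑ (d i) (λ k → I i k * A k j) ⟨
    d i * ∑ (λ k → I i k * A k j)   ≈⟨ *-congˡ (∑-siftˡ i (λ k → A k j)) ⟩
    d i * A i j                     ∎

  ⊛-diag : ∀ {n} (A : Matrix n) (d : Fin n → Carrier) i j → (A ⊛ diag d) i j ≈ A i j * d j
  ⊛-diag A d i j = begin
    ∑ (λ k → A i k * (d k * I k j)) ≈⟨ ∑-cong (λ k → *-assoc (A i k) (d k) (I k j)) ⟨
    ∑ (λ k → (A i k * d k) * I k j) ≈⟨ ∑-siftʳ j (λ k → A i k * d k) ⟩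
    A i j * d j                     ∎

  diag-⊛-diag : ∀ {n} {d e : Fin n → Carrier} → (∀ i → d i * e i ≈ 1#) → (diag d ⊛ diag e) ≋ I
  diag-⊛-diag {d = d} {e} de≈1 i j = begin
    (diag d ⊛ diag e) i j ≈⟨ diag-⊛ d (diag e) i j ⟩
    d i * (e i * I i j)   ≈⟨ *-assoc _ _ _ ⟨
    (d i * e i) * I i j   ≈⟨ *-congʳ (de≈1 i) ⟩
    1# * I i j            ≈⟨ *-identityˡ _ ⟩
    I i j                 ∎


module Invertibility {d ℓ} (F : Field d ℓ) where
  open Field F
  open FieldOps F
  open Matrices F
  module ≈-Reasoning = Relation.Binary.Reasoning.Setoid setoid
  module ≋-Reasoning {n} = Relation.Binary.Reasoning.Setoid (≋-setoid n)

  Inverse : ∀ {n} → Matrix n → Matrix n → Set ℓ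
  Inverse A B = (A ⊛ B) ≋ I × (B ⊛ A) ≋ I

  Inverse-sym : ∀ {n} {A B : Matrix n} → Inverse A B → Inverse B A
  Inverse-sym (AB≋I , BA≋I) = BA≋I , AB≋I

  Inverse-respˡ : ∀ {n} {A A′ B : Matrix n} → A ≋ A′ → Inverse A B → Inverse A′ B
  Inverse-respˡ A≋A′ (AB≋I , BA≋I) =
    ≋.trans (⊛-cong (≋.sym A≋A′) ≋.refl) AB≋I , ≋.trans (⊛-cong ≋.refl (≋.sym A≋A′)) BA≋I

  ⊛-inverseʳ : ∀ {n} {A A′ B B′ : Matrix n} → (A ⊛ A′) ≋ I → (B ⊛ B′) ≋ I → ((A ⊛ B) ⊛ (B′ ⊛ A′)) ≋ I
  ⊛-inverseʳ {n} {A} {A′} {B} {B′} AA′≋I BB′≋I = begin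
    (A ⊛ B) ⊛ (B′ ⊛ A′) ≈⟨ ⊛-assoc A B (B′ ⊛ A′) ⟩
    A ⊛ (B ⊛ (B′ ⊛ A′)) ≈⟨ ⊛-cong ≋.refl (⊛-assoc B B′ A′) ⟨
    A ⊛ ((B ⊛ B′) ⊛ A′) ≈⟨ ⊛-cong ≋.refl (⊛-cong BB′≋I ≋.refl) ⟩
    A ⊛ (I ⊛ A′)        ≈⟨ ⊛-cong ≋.refl (⊛-identityˡ A′) ⟩
    A ⊛ A′              ≈⟨ AA′≋I ⟩
    I                   ∎
    where open ≋-Reasoning

  Inverse-⊛ : ∀ {n} {A A′ B B′ : Matrix n} → Inverse A A′ → Inverse B B′ → Inverse (A ⊛ B) (B′ ⊛ A′)
  Inverse-⊛ (AA′≋I , A′A≋I) (BB′≋I , B′B≋I) = ⊛-inverseʳ AA′≋I BB′≋I , ⊛-inverseʳ B′B≋I A′A≋I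

  Invertible-ᵀ : ∀ {n} {A : Matrix n} → Invertible A → Invertible (A ᵀ)
  Invertible-ᵀ {A = A} (B , AB≋I , BA≋I) = B ᵀ ,
    ≋.trans (≋.sym (⊛-ᵀ B A)) (≋.trans (λ i j → BA≋I j i) I-ᵀ) ,
    ≋.trans (≋.sym (⊛-ᵀ A B)) (≋.trans (λ i j → AB≋I j i) I-ᵀ)

  Invertible-resp : ∀ {n} {A B : Matrix n} → A ≋ B → Invertible A ⇔ Invertible B
  Invertible-resp A≋B = mk⇔ (λ (C , inv) → C , Inverse-respˡ A≋B inv)
                             (λ (C , inv) → C , Inverse-respˡ (≋.sym A≋B) inv)

  Invertible-⊛-⊛ : ∀ {n} {P Q D : Matrix n} → Invertible P → Invertible Q →
                   Invertible (P ⊛ (D ⊛ Q)) ⇔ Invertible D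
  Invertible-⊛-⊛ {n} {P} {Q} {D} (P′ , PP′) (Q′ , QQ′) = mk⇔
    (λ (C , inv) → Q ⊛ (C ⊛ P) ,
       Inverse-respˡ cancel (Inverse-⊛ (Inverse-⊛ (Inverse-sym PP′) inv) (Inverse-sym QQ′)))
    (λ (C , inv) → (Q′ ⊛ C) ⊛ P′ , Inverse-⊛ PP′ (Inverse-⊛ inv QQ′))
    where
    open ≋-Reasoning
    cancel : ((P′ ⊛ (P ⊛ (D ⊛ Q))) ⊛ Q′) ≋ D
    cancel = begin
      (P′ ⊛ (P ⊛ (D ⊛ Q))) ⊛ Q′ ≈⟨ ⊛-cong (⊛-assoc P′ P (D ⊛ Q)) ≋.refl ⟨
      ((P′ ⊛ P) ⊛ (D ⊛ Q)) ⊛ Q′ ≈⟨ ⊛-cong (⊛-cong (proj₂ PP′) ≋.refl) ≋.refl ⟩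
      (I ⊛ (D ⊛ Q)) ⊛ Q′        ≈⟨ ⊛-cong (⊛-identityˡ (D ⊛ Q)) ≋.refl ⟩
      (D ⊛ Q) ⊛ Q′              ≈⟨ ⊛-assoc D Q Q′ ⟩
      D ⊛ (Q ⊛ Q′)              ≈⟨ ⊛-cong ≋.refl (proj₁ QQ′) ⟩
      D ⊛ I                     ≈⟨ ⊛-identityʳ D ⟩
      D                         ∎

  diag-invertible⇔nonzero : ∀ {n} (d : Fin n → Carrier) → Invertible (diag d) ⇔ (∀ i → ¬ d i ≈ 0#)
  diag-invertible⇔nonzero d = mk⇔
    (λ (C , DC≋I , _) i dᵢ≈0 → 0≉1 (let open ≈-Reasoning in begin
      0#               ≈⟨ zeroˡ _ ⟨
      0# * C i i       ≈⟨ *-congʳ dᵢ≈0 ⟨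
      d i * C i i      ≈⟨ diag-⊛ d C i i ⟨
      (diag d ⊛ C) i i ≈⟨ DC≋I i i ⟩
      I i i            ≡⟨ I-diagonal i ⟩
      1#               ∎))
    (λ d≉0 → diag (λ i → d i ⁻¹) ,
      diag-⊛-diag (λ i → ⁻¹-inverseʳ (d i) (d≉0 i)) ,
      diag-⊛-diag (λ i → trans (*-comm _ _) (⁻¹-inverseʳ (d i) (d≉0 i))))

module LatticeLemmas {c ℓ₁ ℓ₂} (L : Lattice c ℓ₁ ℓ₂) where
  open Lattice L
  open LatticeOps L using (⋁)
  open MeetSemilatticeProperties meetSemilattice using (∧-comm; y≤x⇒x∧y≈y)

  ⋁-upperBound : ∀ {k} (h : Fin (suc k) → Carrier) i → h i ≤ ⋁ h
  ⋁-upperBound {zero}  h fzero    = refl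
  ⋁-upperBound {suc k} h fzero    = x≤x∨y _ _
  ⋁-upperBound {suc k} h (fsuc i) = trans (⋁-upperBound (h ∘ fsuc) i) (y≤x∨y _ _)

  x≤y⇒x∧y≈x : ∀ {p q} → p ≤ q → (p ∧ q) ≈ p
  x≤y⇒x∧y≈x {p} {q} p≤q = Eq.trans (∧-comm p q) (y≤x⇒x∧y≈y p≤q)

  x∧y≈x⇒x≤y : ∀ {p q} → (p ∧ q) ≈ p → p ≤ q
  x∧y≈x⇒x≤y {p} {q} p∧q≈p = trans (reflexive (Eq.sym p∧q≈p)) (x∧y≤y p q)

module JoinMatrices {c ℓ₁ ℓ₂ d ℓ} (L : Lattice c ℓ₁ ℓ₂) (F : Field d ℓ) where
  open Lattice L using (_∧_; _∨_) renaming (Carrier to P)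
  open Field F
  open FieldOps F
  open Inverses F
  open Matrices F
  open Invertibility F
  open import Relation.Binary.Reasoning.Setoid setoid
  open import Algebra.Properties.CommutativeSemigroup *-commutativeSemigroup using (x∙yz≈y∙xz)

  meetMatrix : ∀ {n} → (P → Carrier) → (Fin n → P) → Matrix n
  meetMatrix g x i j = g (x i ∧ x j)

  joinMatrix-factorisation : ∀ {n} {f : P → Carrier} → Semimultiplicative L F f → (∀ y → ¬ f y ≈ 0#) →
    (x : Fin n → P) → joinMatrix L F f x ≋ (diag (f ∘ x) ⊛ (meetMatrix (λ y → f y ⁻¹) x ⊛ diag (f ∘ x)))
  joinMatrix-factorisation {f = f} semi f≉0 x i j = begin
    f (x i ∨ x j)                                      ≈⟨ *-identityˡ _ ⟨
    1# * f (x i ∨ x j)                                 ≈⟨ *-congʳ (⁻¹-inverseˡ _ (f≉0 _)) ⟨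
    (f⁻¹ (x i ∧ x j) * f (x i ∧ x j)) * f (x i ∨ x j)  ≈⟨ *-assoc _ _ _ ⟩
    f⁻¹ (x i ∧ x j) * (f (x i ∧ x j) * f (x i ∨ x j))  ≈⟨ *-congˡ (semi (x i) (x j)) ⟨
    f⁻¹ (x i ∧ x j) * (f (x i) * f (x j))              ≈⟨ x∙yz≈y∙xz _ _ _ ⟩
    f (x i) * (f⁻¹ (x i ∧ x j) * f (x j))              ≈⟨ *-congˡ (⊛-diag M (f ∘ x) i j) ⟨
    f (x i) * (M ⊛ diag (f ∘ x)) i j                   ≈⟨ diag-⊛ (f ∘ x) (M ⊛ diag (f ∘ x)) i j ⟨
    (diag (f ∘ x) ⊛ (M ⊛ diag (f ∘ x))) i j            ∎
    where
    f⁻¹ : P → Carrier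
    f⁻¹ y = f y ⁻¹
    M : Matrix _
    M = meetMatrix f⁻¹ x

  joinMatrix-invertible⇔meetMatrix-invertible : ∀ {n} {f : P → Carrier} →
    Semimultiplicative L F f → (∀ y → ¬ f y ≈ 0#) → (x : Fin n → P) →
    Invertible (joinMatrix L F f x) ⇔ Invertible (meetMatrix (λ y → f y ⁻¹) x)
  joinMatrix-invertible⇔meetMatrix-invertible {f = f} semi f≉0 x =
    ⇔-trans (Invertible-resp (joinMatrix-factorisation semi f≉0 x))
            (Invertible-⊛-⊛ diag-f-invertible diag-f-invertible)
    where
    diag-f-invertible : Invertible (diag (f ∘ x))
    diag-f-invertible = Equivalence.from (diag-invertible⇔nonzero _) (λ i → f≉0 (x i))

lastCase : ∀ {a} {A : Set a} {n} → (Fin n → A) → A → Fin (suc n) → A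
lastCase {n = zero}  f z fzero    = z
lastCase {n = suc n} f z fzero    = f fzero
lastCase {n = suc n} f z (fsuc i) = lastCase (f ∘ fsuc) z i

module _ {a} {A : Set a} where

  lastCase-inject₁ : ∀ {n} (f : Fin n → A) z k → lastCase f z (inject₁ k) ≡ f k
  lastCase-inject₁ {suc n} f z fzero    = ≡.refl
  lastCase-inject₁ {suc n} f z (fsuc k) = lastCase-inject₁ (f ∘ fsuc) z k

  lastCase-fromℕ : ∀ n (f : Fin n → A) z → lastCase f z (fromℕ n) ≡ z
  lastCase-fromℕ zero    f z = ≡.refl
  lastCase-fromℕ (suc n) f z = lastCase-fromℕ n (f ∘ fsuc) z

  lastCase-natural : ∀ {b} {B : Set b} {n} (h : A → B) (f : Fin n → A) z i →
                     h (lastCase f z i) ≡ lastCase (h ∘ f) (h z) i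
  lastCase-natural {n = zero}  h f z fzero    = ≡.refl
  lastCase-natural {n = suc n} h f z fzero    = ≡.refl
  lastCase-natural {n = suc n} h f z (fsuc i) = lastCase-natural h (f ∘ fsuc) z i

lastCase-η : ∀ {n} (i : Fin (suc n)) → lastCase inject₁ (fromℕ n) i ≡ i
lastCase-η {zero}  fzero    = ≡.refl
lastCase-η {suc n} fzero    = ≡.refl
lastCase-η {suc n} (fsuc i) =
  ≡.trans (≡.sym (lastCase-natural fsuc inject₁ (fromℕ n) i)) (≡.cong fsuc (lastCase-η i))

module Layers (m : ℕ) where

  data Layer : Set where
    bot : Layer
    mid : Fin (suc m) → Layer
    top : Layer

  pos : Layer → Fin (suc (suc (suc m)))
  pos bot     = fzero
  pos (mid k) = fsuc (inject₁ k)
  pos top     = fromℕ (suc (suc m))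

  layer : Fin (suc (suc (suc m))) → Layer
  layer fzero    = bot
  layer (fsuc i) = lastCase mid top i

  layer-pos : ∀ u → layer (pos u) ≡ u
  layer-pos bot     = ≡.refl
  layer-pos (mid k) = lastCase-inject₁ mid top k
  layer-pos top     = lastCase-fromℕ (suc m) mid top

  pos-layer : ∀ i → pos (layer i) ≡ i
  pos-layer fzero    = ≡.refl
  pos-layer (fsuc i) = begin
    pos (lastCase mid top i)                                ≡⟨ lastCase-natural pos mid top i ⟩
    lastCase (fsuc ∘ inject₁) (fsuc (fromℕ (suc m))) i      ≡⟨ lastCase-natural fsuc inject₁ (fromℕ (suc m)) i ⟨
    fsuc (lastCase inject₁ (fromℕ (suc m)) i)               ≡⟨ ≡.cong fsuc (lastCase-η i) ⟩
    fsuc i                                                  ∎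
    where open ≡.≡-Reasoning

  ∀-layer⇔∀ : ∀ {p} {Q : Layer → Set p} → (∀ i → Q (layer i)) ⇔ (∀ u → Q u)
  ∀-layer⇔∀ {Q = Q} = mk⇔ (λ q u → ≡.subst Q (layer-pos u) (q (pos u))) (λ q i → q (layer i))

module Blocks {d ℓ} (F : Field d ℓ) (m : ℕ) where
  open Field F
  open FieldOps F
  open Sums F
  open Matrices F
  open Invertibility F using (Inverse)
  open Layers m
  open import Relation.Binary.Reasoning.Setoid setoid
  open import Tactic.RingSolver.Core.AlmostCommutativeRing using (fromCommutativeRing)
  open import Tactic.RingSolver.NonReflective (fromCommutativeRing commutativeRing (λ _ → nothing))
    using (solve; _⊜_; _⊕_)
  open RingProperties ring using (-1*x≈-x; -0#≈0#)

  ∑ᴸ : (Layer → Carrier) → Carrier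
  ∑ᴸ ψ = ψ bot + (∑ (ψ ∘ mid) + ψ top)

  ∑-layer : ∀ ψ → ∑ (ψ ∘ layer) ≈ ∑ᴸ ψ
  ∑-layer ψ = +-congˡ (trans (∑-init-last (ψ ∘ layer ∘ fsuc))
    (+-cong (∑-cong λ k → reflexive (≡.cong ψ (layer-pos (mid k)))) (reflexive (≡.cong ψ (layer-pos top)))))

  Block : Set d
  Block = Layer → Layer → Carrier

  lift : Block → Matrix (suc (suc (suc m)))
  lift X i j = X (layer i) (layer j)

  _⊙_ : Block → Block → Block
  (X ⊙ Y) u v = ∑ᴸ (λ w → X u w * Y w v)

  lift-⊛ : ∀ X Y → (lift X ⊛ lift Y) ≋ lift (X ⊙ Y)
  lift-⊛ X Y i j = ∑-layer (λ w → X (layer i) w * Y w (layer j))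

  lift-≋ : ∀ {X A} → (∀ u v → X u v ≈ A (pos u) (pos v)) → lift X ≋ A
  lift-≋ {X} {A} X≈A i j = trans (X≈A (layer i) (layer j)) (reflexive (≡.cong₂ A (pos-layer i) (pos-layer j)))

  Iᴸ : Block
  Iᴸ bot     bot     = 1#
  Iᴸ (mid k) (mid l) = I k l
  Iᴸ top     top     = 1#
  Iᴸ _       _       = 0#

  lift-I : lift Iᴸ ≋ I
  lift-I = lift-≋ entry
    where
    entry : ∀ u v → Iᴸ u v ≈ I (pos u) (pos v)
    entry bot     bot     = refl
    entry bot     (mid l) = refl
    entry bot     top     = refl
    entry (mid k) bot     = refl
    entry (mid k) (mid l) = reflexive (≡.sym (I-inject₁ k l))
    entry (mid k) top     = reflexive (≡.sym (I-offDiagonal (fromℕ≢inject₁ {i = k} ∘ ≡.sym)))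
    entry top     bot     = refl
    entry top     (mid l) = reflexive (≡.sym (I-offDiagonal (fromℕ≢inject₁ {i = l})))
    entry top     top     = reflexive (≡.sym (I-diagonal (fromℕ (suc (suc m)))))

  lift-Inverse : ∀ {X Y} → (∀ u v → (X ⊙ Y) u v ≈ Iᴸ u v) → (∀ u v → (Y ⊙ X) u v ≈ Iᴸ u v) →
                 Inverse (lift X) (lift Y)
  lift-Inverse {X} {Y} XY≈I YX≈I =
    (λ i j → trans (lift-⊛ X Y i j) (trans (XY≈I (layer i) (layer j)) (lift-I i j))) ,
    (λ i j → trans (lift-⊛ Y X i j) (trans (YX≈I (layer i) (layer j)) (lift-I i j)))

  -- ζ u w = 1 exactly when w ≤ u in the order bot < mid k < top with the mid k
  -- pairwise incomparable; μ is its inverse, the Möbius function of that order.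
  ζ : Block
  ζ bot     bot     = 1#
  ζ (mid k) bot     = 1#
  ζ (mid k) (mid l) = I k l
  ζ top     _       = 1#
  ζ _       _       = 0#

  μ : Block
  μ bot     bot     = 1#
  μ (mid k) bot     = - 1#
  μ (mid k) (mid l) = I k l
  μ top     bot     = m · 1#
  μ top     (mid l) = - 1#
  μ top     top     = 1#
  μ _       _       = 0#

  ζ⊙-bot : ∀ Y v → (ζ ⊙ Y) bot v ≈ Y bot v
  ζ⊙-bot Y v = begin
    1# * Y bot v + (∑ (λ k → 0# * Y (mid k) v) + 0# * Y top v)
      ≈⟨ +-cong (*-identityˡ _) (+-cong (∑-zero λ k → zeroˡ (Y (mid k) v)) (zeroˡ _)) ⟩
    Y bot v + (0# + 0#) ≈⟨ +-congˡ (+-identityˡ 0#) ⟩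
    Y bot v + 0#        ≈⟨ +-identityʳ _ ⟩
    Y bot v             ∎

  ζ⊙-mid : ∀ Y k v → (ζ ⊙ Y) (mid k) v ≈ Y bot v + Y (mid k) v
  ζ⊙-mid Y k v = begin
    1# * Y bot v + (∑ (λ l → I k l * Y (mid l) v) + 0# * Y top v)
      ≈⟨ +-cong (*-identityˡ _) (+-cong (∑-siftˡ k (λ l → Y (mid l) v)) (zeroˡ _)) ⟩
    Y bot v + (Y (mid k) v + 0#) ≈⟨ +-congˡ (+-identityʳ _) ⟩
    Y bot v + Y (mid k) v        ∎

  ζ⊙-top : ∀ Y v → (ζ ⊙ Y) top v ≈ ∑ᴸ (λ w → Y w v)
  ζ⊙-top Y v = +-cong (*-identityˡ _) (+-cong (∑-cong λ k → *-identityˡ (Y (mid k) v)) (*-identityˡ _))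

  -- ζ and μ have the same bottom row.
  μ⊙-bot : ∀ Y v → (μ ⊙ Y) bot v ≈ Y bot v
  μ⊙-bot = ζ⊙-bot

  μ⊙-mid : ∀ Y k v → (μ ⊙ Y) (mid k) v ≈ Y (mid k) v - Y bot v
  μ⊙-mid Y k v = begin
    - 1# * Y bot v + (∑ (λ l → I k l * Y (mid l) v) + 0# * Y top v)
      ≈⟨ +-cong (-1*x≈-x _) (+-cong (∑-siftˡ k (λ l → Y (mid l) v)) (zeroˡ _)) ⟩
    - Y bot v + (Y (mid k) v + 0#) ≈⟨ +-congˡ (+-identityʳ _) ⟩
    - Y bot v + Y (mid k) v        ≈⟨ +-comm _ _ ⟩
    Y (mid k) v - Y bot v          ∎

  μ⊙-top : ∀ Y v → (μ ⊙ Y) top v ≈ (m · 1#) * Y bot v + (Y top v - ∑ (λ l → Y (mid l) v))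
  μ⊙-top Y v = +-congˡ (begin
    ∑ (λ l → - 1# * Y (mid l) v) + 1# * Y top v
      ≈⟨ +-cong (*-distribˡ-∑ (- 1#) (λ l → Y (mid l) v)) (sym (*-identityˡ _)) ⟨
    - 1# * ∑ (λ l → Y (mid l) v) + Y top v      ≈⟨ +-congʳ (-1*x≈-x _) ⟩
    - ∑ (λ l → Y (mid l) v) + Y top v           ≈⟨ +-comm _ _ ⟩
    Y top v - ∑ (λ l → Y (mid l) v)             ∎)

  ζ⊙μ : ∀ u v → (ζ ⊙ μ) u v ≈ Iᴸ u v
  ζ⊙μ bot     bot     = ζ⊙-bot μ bot
  ζ⊙μ bot     (mid l) = ζ⊙-bot μ (mid l)
  ζ⊙μ bot     top     = ζ⊙-bot μ top
  ζ⊙μ (mid k) bot     = trans (ζ⊙-mid μ k bot) (-‿inverseʳ 1#)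
  ζ⊙μ (mid k) (mid l) = trans (ζ⊙-mid μ k (mid l)) (+-identityˡ _)
  ζ⊙μ (mid k) top     = trans (ζ⊙-mid μ k top) (+-identityˡ _)
  ζ⊙μ top     bot     = trans (ζ⊙-top μ bot) (begin
    1# + (∑ {suc m} (λ _ → - 1#) + m · 1#) ≈⟨ +-congˡ (+-congʳ (∑-const (suc m) (- 1#))) ⟩
    1# + ((- 1# + m · (- 1#)) + m · 1#)    ≈⟨ +-congˡ (+-congʳ (+-congˡ (·-neg m 1#))) ⟩
    1# + ((- 1# + - (m · 1#)) + m · 1#)
      ≈⟨ solve 4 (λ o o′ t t′ → (o ⊕ ((o′ ⊕ t′) ⊕ t)) ⊜ ((o ⊕ o′) ⊕ (t ⊕ t′))) refl
                 1# (- 1#) (m · 1#) (- (m · 1#)) ⟩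
    (1# - 1#) + (m · 1# - m · 1#)          ≈⟨ +-cong (-‿inverseʳ 1#) (-‿inverseʳ (m · 1#)) ⟩
    0# + 0#                                ≈⟨ +-identityˡ 0# ⟩
    0#                                     ∎)
  ζ⊙μ top     (mid l) = trans (ζ⊙-top μ (mid l)) (begin
    0# + (∑ (λ k → I k l) + - 1#) ≈⟨ +-identityˡ _ ⟩
    ∑ (λ k → I k l) + - 1#        ≈⟨ +-congʳ (∑-I-column l) ⟩
    1# - 1#                       ≈⟨ -‿inverseʳ 1# ⟩
    0#                            ∎)
  ζ⊙μ top     top     = trans (ζ⊙-top μ top)
    (trans (+-identityˡ _) (trans (+-congʳ (∑-zero {suc m} λ _ → refl)) (+-identityˡ 1#)))

  μ⊙ζ : ∀ u v → (μ ⊙ ζ) u v ≈ Iᴸ u v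
  μ⊙ζ bot     bot     = μ⊙-bot ζ bot
  μ⊙ζ bot     (mid l) = μ⊙-bot ζ (mid l)
  μ⊙ζ bot     top     = μ⊙-bot ζ top
  μ⊙ζ (mid k) bot     = trans (μ⊙-mid ζ k bot) (-‿inverseʳ 1#)
  μ⊙ζ (mid k) (mid l) = trans (μ⊙-mid ζ k (mid l)) (trans (+-congˡ -0#≈0#) (+-identityʳ _))
  μ⊙ζ (mid k) top     = trans (μ⊙-mid ζ k top) (-‿inverseʳ 0#)
  μ⊙ζ top     bot     = trans (μ⊙-top ζ bot) (begin
    (m · 1#) * 1# + (1# - ∑ {suc m} (λ _ → 1#))
      ≈⟨ +-cong (*-identityʳ _) (+-congˡ (-‿cong (∑-const (suc m) 1#))) ⟩
    m · 1# + (1# - (1# + m · 1#))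
      ≈⟨ solve 3 (λ t o s → (t ⊕ (o ⊕ s)) ⊜ ((o ⊕ t) ⊕ s)) refl (m · 1#) 1# (- (1# + m · 1#)) ⟩
    (1# + m · 1#) - (1# + m · 1#)                 ≈⟨ -‿inverseʳ _ ⟩
    0#                                           ∎)
  μ⊙ζ top     (mid l) = trans (μ⊙-top ζ (mid l)) (begin
    (m · 1#) * 0# + (1# - ∑ (λ k → I k l)) ≈⟨ +-cong (zeroʳ _) (+-congˡ (-‿cong (∑-I-column l))) ⟩
    0# + (1# - 1#)                         ≈⟨ +-identityˡ _ ⟩
    1# - 1#                                ≈⟨ -‿inverseʳ 1# ⟩
    0#                                     ∎)
  μ⊙ζ top     top     = trans (μ⊙-top ζ top) (begin
    (m · 1#) * 0# + (1# - ∑ {suc m} (λ _ → 0#))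
      ≈⟨ +-cong (zeroʳ _) (+-congˡ (-‿cong (∑-zero {suc m} λ _ → refl))) ⟩
    0# + (1# - 0#)                               ≈⟨ +-identityˡ _ ⟩
    1# - 0#                                      ≈⟨ +-congˡ -0#≈0# ⟩
    1# + 0#                                      ≈⟨ +-identityʳ 1# ⟩
    1#                                           ∎)

  lift-ζ-invertible : Invertible (lift ζ)
  lift-ζ-invertible = lift μ , lift-Inverse {ζ} {μ} ζ⊙μ μ⊙ζ

module ThreeLayerMeetMatrices {c ℓ₁ ℓ₂ d ℓ} (L : Lattice c ℓ₁ ℓ₂) (F : Field d ℓ)
  (g : Lattice.Carrier L → Field.Carrier F) (g-resp : Respects≈ L F g)
  (m : ℕ) (x : Fin (suc (suc (suc m))) → Lattice.Carrier L)
  (meets : ∀ (i j : Fin (suc (suc m))) → i ≢ j →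
           Lattice._≈_ L (Lattice._∧_ L (x (inject₁ i)) (x (inject₁ j))) (x fzero))
  (joins : Lattice._≤_ L (LatticeOps.⋁ L (λ (i : Fin (suc (suc m))) → x (inject₁ i)))
                         (x (fromℕ (suc (suc m)))))
  where

  private
    module L = Lattice L
    module M = MeetSemilatticeProperties L.meetSemilattice
  open LatticeOps L using (⋁)
  open LatticeLemmas L
  open Field F
  open FieldOps F
  open Sums F
  open Matrices F
  open Invertibility F
  open JoinMatrices L F using (meetMatrix)
  open Layers m
  open Blocks F m
  open import Relation.Binary.Reasoning.Setoid setoid
  open RingProperties ring using (xyx⁻¹≈y; x∙y⁻¹≈ε⇒x≈y; x≈y⇒x∙y⁻¹≈ε)
  open import Tactic.RingSolver.Core.AlmostCommutativeRing using (fromCommutativeRing)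
  open import Tactic.RingSolver.NonReflective (fromCommutativeRing commutativeRing (λ _ → nothing))
    using (solve; _⊜_; _⊕_)

  y : Layer → L.Carrier
  y = x ∘ pos

  bot≤ : ∀ u → y bot L.≤ y u
  bot≤ bot     = L.refl
  bot≤ (mid k) = x∧y≈x⇒x≤y (meets fzero (fsuc k) λ ())
  bot≤ top     = L.trans (⋁-upperBound (x ∘ inject₁) fzero) joins

  ≤top : ∀ u → y u L.≤ y top
  ≤top bot     = bot≤ top
  ≤top (mid k) = L.trans (⋁-upperBound (x ∘ inject₁) (fsuc k)) joins
  ≤top top     = L.refl

  -- The Möbius transform of g ∘ y; see ∑-below.
  δ-mid : Fin (suc m) → Carrier
  δ-mid k = g (y (mid k)) - g (y bot)

  δ : Layer → Carrier
  δ bot     = g (y bot)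
  δ (mid k) = δ-mid k
  δ top     = g (y top) - (g (y bot) + ∑ δ-mid)

  x+[y-x]≈y : ∀ p q → p + (q - p) ≈ q
  x+[y-x]≈y p q = trans (sym (+-assoc p q (- p))) (xyx⁻¹≈y p q)

  ∑-below : ∀ v → ∑ᴸ (λ w → δ w * ζ v w) ≈ g (y v)
  ∑-below bot = begin
    g (y bot) * 1# + (∑ (λ k → δ-mid k * 0#) + δ top * 0#)
      ≈⟨ +-cong (*-identityʳ _) (+-cong (∑-zero λ k → zeroʳ (δ-mid k)) (zeroʳ _)) ⟩
    g (y bot) + (0# + 0#) ≈⟨ +-congˡ (+-identityˡ 0#) ⟩
    g (y bot) + 0#        ≈⟨ +-identityʳ _ ⟩
    g (y bot)             ∎
  ∑-below (mid k) = begin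
    g (y bot) * 1# + (∑ (λ l → δ-mid l * I k l) + δ top * 0#)
      ≈⟨ +-cong (*-identityʳ _) (+-cong (∑-cong λ l → *-congˡ {δ-mid l} (reflexive (I-sym k l))) (zeroʳ _)) ⟩
    g (y bot) + (∑ (λ l → δ-mid l * I l k) + 0#) ≈⟨ +-congˡ (trans (+-identityʳ _) (∑-siftʳ k δ-mid)) ⟩
    g (y bot) + δ-mid k                          ≈⟨ x+[y-x]≈y _ _ ⟩
    g (y (mid k))                                ∎
  ∑-below top = begin
    g (y bot) * 1# + (∑ (λ k → δ-mid k * 1#) + δ top * 1#)
      ≈⟨ +-cong (*-identityʳ _) (+-cong (∑-cong λ k → *-identityʳ (δ-mid k)) (*-identityʳ _)) ⟩
    g (y bot) + (∑ δ-mid + δ top) ≈⟨ +-assoc _ _ _ ⟨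
    (g (y bot) + ∑ δ-mid) + δ top ≈⟨ x+[y-x]≈y _ _ ⟩
    g (y top)                     ∎

  Δζᵀ : Block
  Δζᵀ w v = δ w * ζ v w

  ζ-bot-column : ∀ v → ζ v bot ≡ 1#
  ζ-bot-column bot     = ≡.refl
  ζ-bot-column (mid k) = ≡.refl
  ζ-bot-column top     = ≡.refl

  ζ⊙Δζᵀ≈meets : ∀ u v → (ζ ⊙ Δζᵀ) u v ≈ g (y u L.∧ y v)
  ζ⊙Δζᵀ≈meets bot v = begin
    (ζ ⊙ Δζᵀ) bot v       ≈⟨ ζ⊙-bot Δζᵀ v ⟩
    g (y bot) * ζ v bot   ≈⟨ trans (*-congˡ (reflexive (ζ-bot-column v))) (*-identityʳ _) ⟩
    g (y bot)             ≈⟨ g-resp (x≤y⇒x∧y≈x (bot≤ v)) ⟨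
    g (y bot L.∧ y v)     ∎
  ζ⊙Δζᵀ≈meets (mid k) v = trans (ζ⊙-mid Δζᵀ k v) (entry v)
    where
    entry : ∀ v → Δζᵀ bot v + Δζᵀ (mid k) v ≈ g (y (mid k) L.∧ y v)
    entry bot = begin
      g (y bot) * 1# + δ-mid k * 0# ≈⟨ +-cong (*-identityʳ _) (zeroʳ _) ⟩
      g (y bot) + 0#                ≈⟨ +-identityʳ _ ⟩
      g (y bot)                     ≈⟨ g-resp (M.y≤x⇒x∧y≈y (bot≤ (mid k))) ⟨
      g (y (mid k) L.∧ y bot)       ∎
    entry (mid l) with k ≟ l
    ... | yes ≡.refl = begin
      g (y bot) * 1# + δ-mid k * I k k ≈⟨ +-cong (*-identityʳ _) (*-congˡ (reflexive (I-diagonal k))) ⟩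
      g (y bot) + δ-mid k * 1#         ≈⟨ +-congˡ (*-identityʳ _) ⟩
      g (y bot) + δ-mid k              ≈⟨ x+[y-x]≈y _ _ ⟩
      g (y (mid k))                    ≈⟨ g-resp (M.∧-idempotent (y (mid k))) ⟨
      g (y (mid k) L.∧ y (mid k))      ∎
    ... | no k≢l = begin
      g (y bot) * 1# + δ-mid k * I l k
        ≈⟨ +-cong (*-identityʳ _) (*-congˡ (reflexive (I-offDiagonal (k≢l ∘ ≡.sym)))) ⟩
      g (y bot) + δ-mid k * 0#         ≈⟨ trans (+-congˡ (zeroʳ _)) (+-identityʳ _) ⟩
      g (y bot)                        ≈⟨ g-resp (meets (fsuc k) (fsuc l) (k≢l ∘ suc-injective)) ⟨
      g (y (mid k) L.∧ y (mid l))      ∎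
    entry top = begin
      g (y bot) * 1# + δ-mid k * 1# ≈⟨ +-cong (*-identityʳ _) (*-identityʳ _) ⟩
      g (y bot) + δ-mid k           ≈⟨ x+[y-x]≈y _ _ ⟩
      g (y (mid k))                 ≈⟨ g-resp (x≤y⇒x∧y≈x (≤top (mid k))) ⟨
      g (y (mid k) L.∧ y top)       ∎
  ζ⊙Δζᵀ≈meets top v = begin
    (ζ ⊙ Δζᵀ) top v       ≈⟨ ζ⊙-top Δζᵀ v ⟩
    ∑ᴸ (λ w → Δζᵀ w v)    ≈⟨ ∑-below v ⟩
    g (y v)               ≈⟨ g-resp (M.y≤x⇒x∧y≈y (≤top v)) ⟨
    g (y top L.∧ y v)     ∎

  meetMatrix-factorisation : meetMatrix g x ≋ (lift ζ ⊛ (diag (δ ∘ layer) ⊛ (lift ζ ᵀ)))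
  meetMatrix-factorisation = ≋.sym (≋.trans (⊛-cong {A = lift ζ} ≋.refl (diag-⊛ (δ ∘ layer) (lift ζ ᵀ)))
                                            (≋.trans (lift-⊛ ζ Δζᵀ) (lift-≋ ζ⊙Δζᵀ≈meets)))

  g[bot]+∑δ-mid : g (y bot) + ∑ δ-mid ≈ ∑ (g ∘ y ∘ mid) - m · g (y bot)
  g[bot]+∑δ-mid = begin
    a + ∑ (λ k → g (y (mid k)) - a)           ≈⟨ +-congˡ (∑-distrib-+ (g ∘ y ∘ mid) (λ _ → - a)) ⟩
    a + (S + ∑ {suc m} (λ _ → - a))           ≈⟨ +-congˡ (+-congˡ (∑-const (suc m) (- a))) ⟩
    a + (S + (- a + m · (- a)))               ≈⟨ +-congˡ (+-congˡ (+-congˡ (·-neg m a))) ⟩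
    a + (S + (- a + - (m · a)))
      ≈⟨ solve 4 (λ a a′ S t′ → (a ⊕ (S ⊕ (a′ ⊕ t′))) ⊜ ((S ⊕ t′) ⊕ (a ⊕ a′))) refl a (- a) S (- (m · a)) ⟩
    (S - m · a) + (a - a)                     ≈⟨ +-congˡ (-‿inverseʳ a) ⟩
    (S - m · a) + 0#                          ≈⟨ +-identityʳ _ ⟩
    S - m · a                                 ∎
    where
    a = g (y bot)
    S = ∑ (g ∘ y ∘ mid)

  δ≉0⇔ : (∀ u → ¬ δ u ≈ 0#) ⇔
         (¬ g (y bot) ≈ 0# × (∀ k → ¬ g (y (mid k)) ≈ g (y bot)) ×
          ¬ g (y top) ≈ ∑ (g ∘ y ∘ mid) - m · g (y bot))
  δ≉0⇔ = mk⇔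
    (λ δ≉0 → δ≉0 bot ,
             (λ k eq → δ≉0 (mid k) (x≈y⇒x∙y⁻¹≈ε eq)) ,
             (λ eq → δ≉0 top (x≈y⇒x∙y⁻¹≈ε (trans eq (sym g[bot]+∑δ-mid)))))
    (λ (bot≉0 , mid≉bot , top≉) → λ where
      bot     → bot≉0
      (mid k) → mid≉bot k ∘ x∙y⁻¹≈ε⇒x≈y _ _
      top     → λ δ≈0 → top≉ (trans (x∙y⁻¹≈ε⇒x≈y _ _ δ≈0) g[bot]+∑δ-mid))

  meetMatrix-invertible⇔ : Invertible (meetMatrix g x) ⇔
    (¬ g (y bot) ≈ 0# × (∀ k → ¬ g (y (mid k)) ≈ g (y bot)) ×
     ¬ g (y top) ≈ ∑ (g ∘ y ∘ mid) - m · g (y bot))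
  meetMatrix-invertible⇔ =
    ⇔-trans (Invertible-resp meetMatrix-factorisation)
    (⇔-trans (Invertible-⊛-⊛ {P = lift ζ} {Q = lift ζ ᵀ} {D = diag (δ ∘ layer)}
                             lift-ζ-invertible (Invertible-ᵀ {A = lift ζ} lift-ζ-invertible))
    (⇔-trans (diag-invertible⇔nonzero (δ ∘ layer))
    (⇔-trans ∀-layer⇔∀
             δ≉0⇔)))

open import Data.Nat using (_+_)
open import Data.Fin using () renaming (_<_ to _<ᶠ_)

theorem5p2 : ∀ {c ℓ₁ ℓ₂ d ℓ} (L : Lattice c ℓ₁ ℓ₂) (F : Field d ℓ) →
  let open Lattice L
      open LatticeOps L renaming (_<_ to _⊏_)
      module F = Field F
      open FieldOps F
  in LocallyFinite →
     (f : Carrier → F.Carrier) → Respects≈ L F f → Semimultiplicative L F f →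
     (∀ x → ¬ (f x F.≈ F.0#)) →
     -- n = m + 3 ≥ 3 ; S = {x₁,…,xₙ} with xᵢ = x (i-1)
     (m : ℕ) (x : Fin (3 + m) → Carrier) →
     MeetClosed x →
     (∀ i j → i ≢ j → ¬ (x i ≈ x j)) →
     (∀ i j → x i ⊏ x j → i <ᶠ j) →
     (∀ (i j : Fin (2 + m)) → i ≢ j → (x (inject₁ i) ∧ x (inject₁ j)) ≈ x fzero) →
     ⋁ (λ (i : Fin (2 + m)) → x (inject₁ i)) ≤ x (fromℕ (2 + m)) →
     Invertible (joinMatrix L F f x)
     ⇔ ((∀ (k : Fin (suc m)) → ¬ (f (x (inject₁ (fsuc k))) F.≈ f (x fzero)))
        × ¬ ((f (x (fromℕ (2 + m)))) F.⁻¹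
              F.≈ (∑ (λ (k : Fin (suc m)) → (f (x (inject₁ (fsuc k)))) F.⁻¹)
                    F.- (m · ((f (x fzero)) F.⁻¹)))))
theorem5p2 L F _ f f-resp f-semi f≉0 m x _ _ _ meets joins =
  ⇔-trans (joinMatrix-invertible⇔meetMatrix-invertible f-semi f≉0 x)
  (⇔-trans meetMatrix-invertible⇔
  (mk⇔ (λ (_ , mid≉bot , top≉) → (λ k → mid≉bot k ∘ ⁻¹-cong (f≉0 _)) , top≉)
       (λ (mid≉bot , top≉) →
         ⁻¹-nonzero (f≉0 _) , (λ k → mid≉bot k ∘ ⁻¹-injective (f≉0 _) (f≉0 _)) , top≉)))
  where
  open Field F using (_⁻¹)
  open Inverses F
  open JoinMatrices L F using (joinMatrix-invertible⇔meetMatrix-invertible)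
  open ThreeLayerMeetMatrices L F (λ y → f y ⁻¹) (⁻¹-cong (f≉0 _) ∘ f-resp) m x meets joins
    using (meetMatrix-invertible⇔)
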